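{- Let $q\geq 1$ and $m\geq 0$ be integers, let $G$ be a finite simple graph with more than $m$ vertices, and let $S_1, S_2, \ldots, S_{m}$ be squids in $G\square K_q$ with pairwise different bodies. If $q> |N^2(v)| + 2|N(v)|$ for every vertex $v$ of $G$, then the graph $G\square K_q \setminus \bigcup_{i=1}^m S_i$ is non-empty (has at least one vertex).
   Context: $K_q$ is the complete graph on vertex set $\{1,2,\ldots,q\}$. For graphs $G,H$ the cartesian product $G\square H$ has vertex set $V(G)\times V(H)$, with $(v_1,w_1)$ and $(v_2,w_2)$ adjacent iff either $w_1=w_2$ and $\{v_1,v_2\}\in E(G)$, or $v_1=v_2$ and $\{w_1,w_2\}\in E(H)$. For a vertex $v$ of $G$, $N_G(v)=N(v)$ is the set of neighbours of $v$ in $G$, and $N^2(v)=\left(\bigcup_{u\in N(v)} N(u)\right)\setminus (N(v)\cup\{v\})$. A squid with body $w\in V(G)$ in $G\square K_q$ is a subset of $V(G\square K_q)$, together with the designated body $w$, which is either (i) a subset of $(N_G(v)\cup N_G(w))\times\{i\} \cup \{w\}\times\{1,\ldots, q\}$ for some vertex $v$ adjacent to $w$ and some $1\leq i\leq q$, or (ii) a subset of $N_G(w)\times\{i,j\} \cup \{w\}\times\{1,\ldots, q\}$ for some $1\leq i<j\leq q$. (The body is part of the data.) $G\square K_q\setminus S$ denotes the induced subgraph of $G\square K_q$ on the complement of the vertex set $S$. -}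

module Defs where

open import Data.Nat using (ℕ; _+_; _*_; _<_)
open import Data.Bool using (Bool; true; false; _∧_; _∨_; not)
open import Data.Fin using (Fin) renaming (_<_ to _<ᶠ_)
open import Data.Fin.Properties using (_≟_)
open import Data.Fin.Subset using (Subset; ∣_∣)
open import Data.Vec using (tabulate)
open import Data.Bool.ListAction using (any)
open import Data.List using (allFin)
open import Data.Product using (Σ; _×_; ∃)
open import Data.Sum using (_⊎_)
open import Relation.Binary.PropositionalEquality using (_≡_; _≢_)
open import Relation.Nullary.Decidable using (⌊_⌋)

record Graph (n : ℕ) : Set where
  field
    adj     : Fin n → Fin n → Bool
    symm    : ∀ u v → adj u v ≡ adj v u
    irrefl  : ∀ v → adj v v ≡ false
open Graph public

module _ {n : ℕ} (G : Graph n) where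

  N : Fin n → Subset n
  N v = tabulate (λ u → adj G v u)

  N² : Fin n → Subset n
  N² v = tabulate (λ x →
    any (λ u → adj G v u ∧ adj G u x) (allFin n)
    ∧ not (adj G v x)
    ∧ not ⌊ x ≟ v ⌋)

  -- Subsets of V(G □ K_q) are predicates on Fin n × Fin q.
  -- Type (i): S ⊆ (N(v) ∪ N(w)) × {i} ∪ {w} × [q], for some v ~ w and some i.
  SquidI : {q : ℕ} → Fin n → (Fin n → Fin q → Set) → Set
  SquidI {q} w S = Σ (Fin n) λ v → Σ (Fin q) λ i →
    (adj G v w ≡ true) ×
    (∀ x j → S x j → (x ≡ w) ⊎ ((j ≡ i) × ((adj G v x ∨ adj G w x) ≡ true)))

  SquidII : {q : ℕ} → Fin n → (Fin n → Fin q → Set) → Set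
  SquidII {q} w S = Σ (Fin q) λ i → Σ (Fin q) λ j →
    (i <ᶠ j) ×
    (∀ x k → S x k → (x ≡ w) ⊎ ((adj G w x ≡ true) × ((k ≡ i) ⊎ (k ≡ j))))

  IsSquid : {q : ℕ} → Fin n → (Fin n → Fin q → Set) → Set
  IsSquid w S = SquidI w S ⊎ SquidII w S

-- Some vertex w is the body of no squid, since there are fewer bodies than
-- vertices.  A squid whose body b differs from w meets the column {w} × [q]
-- only if b ∈ N(w) (in at most two colours) or b ∈ N²(w) (type (i), in its
-- one colour, because b ~ v and v ~ w).  The bodies being distinct, at most
-- |N²(w)| + 2|N(w)| < q colours of the column are covered.

module Submission where

open import Defs
open import Data.Nat using (ℕ; zero; suc; _+_; _*_; _<_; _≤_; z≤n; s≤s)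
open import Data.Nat.Properties
  using (+-*-semiring; +-mono-≤; m≤n+m; ≤-<-trans; <-≤-trans; <-irrefl)
open import Data.Fin using (Fin; zero; suc)
open import Data.Fin.Properties using (_≟_; any?; ¬∀⟶∃¬; injective⇒≤)
open import Data.Fin.Subset using (∣_∣)
open import Data.Product using (Σ; ∃; _,_)
open import Data.Sum using (_⊎_; inj₁; inj₂)
open import Data.Bool as Bool using (Bool; true; false; _∧_; _∨_; not; if_then_else_)
open import Data.Bool.ListAction using (any)
open import Data.Bool.Properties using (T-≡; ∧-identityʳ; ∨-identityʳ; ∨-zeroʳ; ¬-not)
open import Data.List as List using (List; []; _∷_; length; concat; allFin; lookup)
open import Data.List.Properties using (length-++; length-tabulate)
open import Data.List.Membership.Propositional using (_∈_; _∉_; lose)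
open import Data.List.Membership.Propositional.Properties
  using (∈-tabulate⁺; ∈-allFin; ∈-concat⁺′)
open import Data.List.Relation.Unary.Any using (here; there; index)
open import Data.List.Relation.Unary.Any.Properties using (lookup-index; any⁺)
open import Data.Vec using (tabulate)
open import Function using (Equivalence)
open import Relation.Nullary using (¬_; yes; no; contradiction)
open import Relation.Nullary.Decidable using (⌊_⌋; isYes≗does; dec-false)
open import Relation.Binary.PropositionalEquality
  using (_≡_; _≢_; refl; sym; trans; cong; cong₂; subst; module ≡-Reasoning)

open import Algebra.Properties.Semiring.Sum +-*-semiring
  using (sum-syntax; ∑-distrib-+; *-distribˡ-sum)

∃-∉-of-length< : {n : ℕ} (xs : List (Fin n)) → length xs < n → ∃ λ j → j ∉ xs
∃-∉-of-length< {n} xs xs<n = ¬∀⟶∃¬ n (_∈ xs) (_∈? xs) all∈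
  where
  open import Data.List.Membership.DecPropositional (_≟_ {n}) using (_∈?_)
  all∈ : ¬ (∀ j → j ∈ xs)
  all∈ j∈xs = <-irrefl refl (<-≤-trans xs<n (injective⇒≤ index-injective))
    where
    index-injective : ∀ {i j} → index (j∈xs i) ≡ index (j∈xs j) → i ≡ j
    index-injective {i} {j} eq = begin
      i                          ≡⟨ lookup-index (j∈xs i) ⟩
      lookup xs (index (j∈xs i)) ≡⟨ cong (lookup xs) eq ⟩
      lookup xs (index (j∈xs j)) ≡⟨ lookup-index (j∈xs j) ⟨
      j                          ∎
      where open ≡-Reasoning

∃-∉-image : {m n : ℕ} → m < n → (f : Fin m → Fin n) → ∃ λ w → ∀ k → f k ≢ w
∃-∉-image m<n f
  with w , w∉ ← ∃-∉-of-length< (List.tabulate f) (subst (_< _) (sym (length-tabulate f)) m<n)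
  = w , λ { k refl → w∉ (∈-tabulate⁺ k) }

𝟙 : Bool → ℕ
𝟙 true  = 1
𝟙 false = 0

∣tabulate∣≡∑𝟙 : {n : ℕ} (p : Fin n → Bool) → ∣ tabulate p ∣ ≡ ∑[ u < n ] 𝟙 (p u)
∣tabulate∣≡∑𝟙 {zero}  p = refl
∣tabulate∣≡∑𝟙 {suc n} p with p zero
... | true  = cong suc (∣tabulate∣≡∑𝟙 (λ u → p (suc u)))
... | false = ∣tabulate∣≡∑𝟙 (λ u → p (suc u))

length-concat-tabulate≤∑ : {A : Set} {n : ℕ} (xs : Fin n → List A) (f : Fin n → ℕ) →
  (∀ u → length (xs u) ≤ f u) → length (concat (List.tabulate xs)) ≤ ∑[ u < n ] f u
length-concat-tabulate≤∑ {n = zero}  xs f xs≤f = z≤n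
length-concat-tabulate≤∑ {n = suc n} xs f xs≤f
  rewrite length-++ (xs zero) {concat (List.tabulate (λ u → xs (suc u)))} =
  +-mono-≤ (xs≤f zero)
    (length-concat-tabulate≤∑ (λ u → xs (suc u)) (λ u → f (suc u)) (λ u → xs≤f (suc u)))

∑𝟙+2*𝟙≡∣tabulate∣+2*∣tabulate∣ : {n : ℕ} (p r : Fin n → Bool) →
  ∑[ u < n ] (𝟙 (p u) + 2 * 𝟙 (r u)) ≡ ∣ tabulate p ∣ + 2 * ∣ tabulate r ∣
∑𝟙+2*𝟙≡∣tabulate∣+2*∣tabulate∣ {n} p r = begin
  ∑[ u < n ] (𝟙 (p u) + 2 * 𝟙 (r u))
    ≡⟨ ∑-distrib-+ (λ u → 𝟙 (p u)) (λ u → 2 * 𝟙 (r u)) ⟩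
  (∑[ u < n ] 𝟙 (p u)) + (∑[ u < n ] (2 * 𝟙 (r u)))
    ≡⟨ cong (_ +_) (*-distribˡ-sum 2 (λ u → 𝟙 (r u))) ⟨
  (∑[ u < n ] 𝟙 (p u)) + 2 * (∑[ u < n ] 𝟙 (r u))
    ≡⟨ cong₂ (λ a b → a + 2 * b) (∣tabulate∣≡∑𝟙 p) (∣tabulate∣≡∑𝟙 r) ⟨
  ∣ tabulate p ∣ + 2 * ∣ tabulate r ∣
    ∎
  where open ≡-Reasoning

module _ {n : ℕ} (G : Graph n) where

  adj-sym : ∀ {u v} → adj G u v ≡ true → adj G v u ≡ true
  adj-sym {u} {v} uv = trans (symm G v u) uv

  -- Literally the predicate tabulated in N² G w, so ∣ N² G w ∣ is ∣ tabulate (inN² w) ∣.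
  inN² : Fin n → Fin n → Bool
  inN² w x = any (λ u → adj G w u ∧ adj G u x) (allFin n) ∧ not (adj G w x) ∧ not ⌊ x ≟ w ⌋

  path²⇒inN² : ∀ {w v x} → adj G w v ≡ true → adj G v x ≡ true →
    adj G w x ≡ false → x ≢ w → inN² w x ≡ true
  path²⇒inN² {w} {v} {x} wv vx wx x≢w
    rewrite wx | isYes≗does (x ≟ w) | dec-false (x ≟ w) x≢w =
      trans (∧-identityʳ _) common-neighbour
    where
    common-neighbour : any (λ u → adj G w u ∧ adj G u x) (allFin n) ≡ true
    common-neighbour = Equivalence.to T-≡
      (any⁺ _ (lose (∈-allFin v) (Equivalence.from T-≡ (cong₂ _∧_ wv vx))))

  adjacent-or-inN² : ∀ {w v b} → adj G v b ≡ true → (adj G v w ∨ adj G b w) ≡ true →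
    b ≢ w → adj G w b ≡ true ⊎ inN² w b ≡ true
  adjacent-or-inN² {w} {v} {b} vb vw∨bw b≢w with adj G w b Bool.≟ true
  ... | yes wb = inj₁ wb
  ... | no ¬wb = inj₂ (path²⇒inN² (adj-sym vw) vb wb b≢w)
    where
    wb : adj G w b ≡ false
    wb = ¬-not ¬wb
    vw : adj G v w ≡ true
    vw = trans (sym (∨-identityʳ _))
               (subst (λ y → (adj G v w ∨ y) ≡ true) (trans (symm G b w) wb) vw∨bw)

module _ {n q : ℕ} (G : Graph n) (w : Fin n) where

  blocked : ∀ {b} {T : Fin n → Fin q → Set} → IsSquid G b T → List (Fin q)
  blocked {b} (inj₁ (_ , i , _))     = if adj G w b ∨ inN² G w b then i ∷ [] else []
  blocked {b} (inj₂ (i , i′ , _ , _)) = if adj G w b then i ∷ i′ ∷ [] else []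

  length-blocked≤ : ∀ {b T} (s : IsSquid G b T) →
    length (blocked s) ≤ 𝟙 (inN² G w b) + 2 * 𝟙 (adj G w b)
  length-blocked≤ {b} (inj₁ (_ , i , _))     = one-colour (adj G w b) (inN² G w b)
    where
    one-colour : ∀ x y → length (if x ∨ y then i ∷ [] else []) ≤ 𝟙 y + 2 * 𝟙 x
    one-colour true  true  = s≤s z≤n
    one-colour true  false = s≤s z≤n
    one-colour false true  = s≤s z≤n
    one-colour false false = z≤n
  length-blocked≤ {b} (inj₂ (i , i′ , _ , _)) = two-colours (adj G w b) (inN² G w b)
    where
    two-colours : ∀ x y → length (if x then i ∷ i′ ∷ [] else []) ≤ 𝟙 y + 2 * 𝟙 x
    two-colours true  y = m≤n+m 2 (𝟙 y)
    two-colours false _ = z≤n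

  ∈-blocked : ∀ {b T j} (s : IsSquid G b T) → b ≢ w → T w j → j ∈ blocked s
  ∈-blocked {b} {j = j} (inj₁ (v , i , vb , T⊆)) b≢w t with T⊆ w j t
  ... | inj₁ w≡b          = contradiction (sym w≡b) b≢w
  ... | inj₂ (refl , vw∨bw) with adjacent-or-inN² G vb vw∨bw b≢w
  ...   | inj₁ wb rewrite wb = here refl
  ...   | inj₂ b∈N² rewrite b∈N² | ∨-zeroʳ (adj G w b) = here refl
  ∈-blocked {b} {j = j} (inj₂ (i , i′ , _ , T⊆)) b≢w t with T⊆ w j t
  ... | inj₁ w≡b               = contradiction (sym w≡b) b≢w
  ... | inj₂ (bw , j≡i⊎j≡i′) rewrite adj-sym G bw with j≡i⊎j≡i′
  ...   | inj₁ refl = here refl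
  ...   | inj₂ refl = there (here refl)

module _ {n m q : ℕ} (G : Graph n) {body : Fin m → Fin n} {S : Fin m → Fin n → Fin q → Set}
         (squid : ∀ k → IsSquid G (body k) (S k)) (w : Fin n) where

  blockedAt : Fin n → List (Fin q)
  blockedAt u with any? (λ k → body k ≟ u)
  ... | yes (k , _) = blocked G w (squid k)
  ... | no _        = []

  length-blockedAt≤ : ∀ u → length (blockedAt u) ≤ 𝟙 (inN² G w u) + 2 * 𝟙 (adj G w u)
  length-blockedAt≤ u with any? (λ k → body k ≟ u)
  ... | yes (k , refl) = length-blocked≤ G w (squid k)
  ... | no _           = z≤n

  ∈-blockedAt : (∀ k l → body k ≡ body l → k ≡ l) → (∀ k → body k ≢ w) →
    ∀ {k j} → S k w j → j ∈ blockedAt (body k)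
  ∈-blockedAt body-injective w-free {k} t with any? (λ l → body l ≟ body k)
  ... | no none = contradiction (k , refl) none
  ... | yes (l , bl≡bk) with body-injective l k bl≡bk
  ...   | refl = ∈-blocked G w (squid k) (w-free k) t

  blockedColours : List (Fin q)
  blockedColours = concat (List.tabulate blockedAt)

  length-blockedColours≤ : length blockedColours ≤ ∣ N² G w ∣ + 2 * ∣ N G w ∣
  length-blockedColours≤ = subst (length blockedColours ≤_)
    (∑𝟙+2*𝟙≡∣tabulate∣+2*∣tabulate∣ (inN² G w) (adj G w))
    (length-concat-tabulate≤∑ blockedAt _ length-blockedAt≤)

  ∈-blockedColours : (∀ k l → body k ≡ body l → k ≡ l) → (∀ k → body k ≢ w) →
    ∀ {k j} → S k w j → j ∈ blockedColours
  ∈-blockedColours body-injective w-free {k} t =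
    ∈-concat⁺′ (∈-blockedAt body-injective w-free t) (∈-tabulate⁺ (body k))

lemma3p4 : (q m n : ℕ) → 1 ≤ q → (G : Graph n) → m < n →
    (body : Fin m → Fin n) → (S : Fin m → Fin n → Fin q → Set) →
    (∀ k → IsSquid G (body k) (S k)) →
    (∀ k l → body k ≡ body l → k ≡ l) →
    (∀ v → ∣ N² G v ∣ + 2 * ∣ N G v ∣ < q) →
    Σ (Fin n) λ x → Σ (Fin q) λ j → ∀ k → ¬ S k x j
-- The hypothesis 1 ≤ q is implied by the degree bound.
lemma3p4 q m n _ G m<n body S squid body-injective degree
  with w , w-free ← ∃-∉-image m<n body
  with j , j∉ ← ∃-∉-of-length< (blockedColours G squid w)
                  (≤-<-trans (length-blockedColours≤ G squid w) (degree w))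
  = w , j , λ k t → j∉ (∈-blockedColours G squid w body-injective w-free t)
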